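{- Let $t\ge0$ and let $x_0,\dots,x_t$ and $\beta$ be arbitrary integers. Define recursively \[ x_\nu:=\beta+\min_{j_1,j_2\ge0,\ j_1+j_2=\nu-1}(x_{j_1}+x_{j_2}),\qquad \nu\ge t+1. \] Let $p$ be any integer in $\operatorname{argmin}_{0\le j\le t}\frac{x_j+\beta}{j+1}$. Then the sequence $\Delta(x)=(x_{\nu+1}-x_\nu)_{\nu\ge0}$ is eventually periodic with period length $p+1$; for all $\nu\ge t+1$ we have $x_\nu-x_{\nu-(p+1)}\le x_p+\beta$, with equality for all sufficiently large $\nu$; and for all $k\ge1$ we have $x_{p+k(p+1)}-x_p\ge k(x_p+\beta)$. -}

module Defs where

open import Data.Nat using (ℕ; zero; suc; _∸_; _<?_; _≤?_; s≤s)
open import Data.Integer using (ℤ; _+_; _⊓_; 0ℤ)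
open import Data.Fin using (Fin; fromℕ<)
open import Relation.Nullary using (yes; no)

minUpTo : ℕ → (ℕ → ℤ) → ℤ
minUpTo zero    g = g 0
minUpTo (suc m) g = minUpTo m g ⊓ g (suc m)

-- value at index n, given the earlier values f 0 … f (n-1):
--   x_n = x0 n                                   if n ≤ t
--   x_n = β + min_{j1+j2 = n-1} (x_j1 + x_j2)    if n ≥ t+1
step : (t : ℕ) → (Fin (suc t) → ℤ) → ℤ → ℕ → (ℕ → ℤ) → ℤ
step t x0 β n f with n ≤? t
... | yes n≤t = x0 (fromℕ< (s≤s n≤t))
... | no  _   = β + minUpTo (n ∸ 1) (λ j → f j + f ((n ∸ 1) ∸ j))

-- approx n agrees with the sequence on indices < n
approx : (t : ℕ) → (Fin (suc t) → ℤ) → ℤ → ℕ → ℕ → ℤ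
approx t x0 β zero    i = 0ℤ
approx t x0 β (suc n) i with i <? n
... | yes _ = approx t x0 β n i
... | no  _ = step t x0 β n (approx t x0 β n)

seqX : (t : ℕ) → (Fin (suc t) → ℤ) → ℤ → ℕ → ℤ
seqX t x0 β ν = approx t x0 β (suc ν) ν

module Submission where

-- Write Y ν = x_ν + β.  For ν > t the recurrence becomes the min-plus law
--   Y ν = min_{a + b = ν - 1} (Y a + Y b),
-- so Y is subadditive there and every such ν has an optimal split ν = 1 + a + b,
-- a ≤ b, with Y ν = Y a + Y b.  Put c = Y p and q = p + 1.
--
-- * The argmin hypothesis, cleared of denominators, is  c (j+1) ≤ q Y j  for j ≤ t;
--   strong induction over optimal splits extends it to every ν (slope-bound).
--   This gives the growth estimate  Y (p + k q) ≥ (k+1) c.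
-- * Subadditivity with the split ν = 1 + p + (ν - q) gives  Y ν ≤ c + Y (ν - q)
--   for ν > t.
-- * For the reverse inequality follow the spine of ν: repeatedly pass to the larger
--   part of an optimal split.  If ν ≥ 2^q (t+1) the first q+1 spine points stay
--   above t, so two of them, S and S', agree mod q.  The pieces split off between
--   them have total size a positive multiple k q of q and cost at least k c
--   (slope-bound), while excising them from ν costs nothing (subadditivity); this
--   forces  Y ν ≥ c + Y (ν - q).

open import Defs
open import Data.Nat using (ℕ; suc; _≤_; _∸_; _*_; _+_)
open import Data.Fin using (Fin; fromℕ<)
open import Data.Integer using (ℤ; +_) renaming (_+_ to _+ℤ_; _-_ to _-ℤ_; _*_ to _*ℤ_; _≤_ to _≤ℤ_)
open import Data.Rational using (ℚ; _/_) renaming (_≤_ to _≤ℚ_)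
open import Data.Product using (Σ; ∃; _×_)
open import Relation.Binary.PropositionalEquality using (_≡_)

open import Data.Nat using (zero; _<_; _^_; _%_; NonZero; _<?_; _≤?_; _≟_; z≤n; s≤s; s≤s⁻¹; z<s)
open import Data.Nat.Properties
  using ( ≤-refl; ≤-trans; ≤-reflexive; <⇒≤; <⇒≱; ≰⇒>; ≤∧≢⇒<; m<1+n⇒m≤n; m≤n⇒m≤1+n; <-irrefl; 1+n≰n; n<1+n
        ; m≤m+n; m≤n+m; n≤1+n; m≤n*m; m^n≢0; ^-monoʳ-≤; *-monoˡ-≤; +-mono-≤; +-monoʳ-<
        ; +-comm; +-assoc; +-suc; +-identityʳ; *-assoc; *-identityˡ; *-distribʳ-∸; +-cancelˡ-≡
        ; m∸n≤m; m+n∸n≡m; m+n∸m≡n; m+[n∸m]≡n; m≤n⇒∃[o]m+o≡n )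
open import Data.Nat.DivMod using (_div_; _mod_; m≡m%n+[m/n]*n)
open import Data.Nat.Divisibility using (_∣_; divides)
open import Data.Nat.Induction using (<-rec)
open import Data.Integer using (_⊓_; 1ℤ) renaming (-_ to -ℤ_)
import Data.Integer.Properties as ℤP
open import Data.Integer.Tactic.RingSolver using (solve-∀)
open import Data.Nat.Tactic.RingSolver using () renaming (solve-∀ to solve-ℕ)
open import Data.Fin using (toℕ)
open import Data.Fin.Properties using (pigeonhole; toℕ<n; fromℕ<-injective)
open import Data.Rational.Properties using (toℚᵘ-mono-≤; toℚᵘ-fromℚᵘ)
open import Data.Rational.Unnormalised using (mkℚᵘ)
import Data.Rational.Unnormalised.Properties as ℚᵘ
open import Data.Product using (_,_; proj₁; proj₂; ∃₂)
open import Data.Sum using (inj₁; inj₂)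
open import Relation.Nullary using (yes; no; contradiction)
open import Relation.Binary.PropositionalEquality using (refl; sym; trans; cong; cong₂; subst; module ≡-Reasoning)

minUpTo-≤ : ∀ m g j → j ≤ m → minUpTo m g ≤ℤ g j
minUpTo-≤ zero    g .zero z≤n = ℤP.≤-refl
minUpTo-≤ (suc m) g j j≤1+m with j ≟ suc m
... | yes refl = ℤP.i⊓j≤j (minUpTo m g) (g (suc m))
... | no  j≢1+m = ℤP.≤-trans (ℤP.i⊓j≤i (minUpTo m g) (g (suc m)))
                            (minUpTo-≤ m g j (m<1+n⇒m≤n (≤∧≢⇒< j≤1+m j≢1+m)))

minUpTo-attained : ∀ m g → ∃ λ j → j ≤ m × minUpTo m g ≡ g j
minUpTo-attained zero    g = 0 , z≤n , refl
minUpTo-attained (suc m) g with ℤP.≤-total (minUpTo m g) (g (suc m))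
... | inj₁ min≤last = let (j , j≤m , eq) = minUpTo-attained m g
                      in j , m≤n⇒m≤1+n j≤m , trans (ℤP.i≤j⇒i⊓j≡i min≤last) eq
... | inj₂ last≤min = suc m , ≤-refl , ℤP.i≥j⇒i⊓j≡j last≤min

minUpTo-cong : ∀ m f g → (∀ j → j ≤ m → f j ≡ g j) → minUpTo m f ≡ minUpTo m g
minUpTo-cong zero    f g f≡g = f≡g 0 z≤n
minUpTo-cong (suc m) f g f≡g =
  cong₂ _⊓_ (minUpTo-cong m f g (λ j j≤m → f≡g j (m≤n⇒m≤1+n j≤m))) (f≡g (suc m) ≤-refl)

minUpTo-+ : ∀ m g k → minUpTo m g +ℤ k ≡ minUpTo m (λ j → g j +ℤ k)
minUpTo-+ zero    g k = refl
minUpTo-+ (suc m) g k =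
  trans (ℤP.mono-≤-distrib-⊓ (ℤP.+-monoˡ-≤ k) (minUpTo m g) (g (suc m)))
        (cong (_⊓ (g (suc m) +ℤ k)) (minUpTo-+ m g k))

[a+k]-k≡a : ∀ a k → (a +ℤ k) -ℤ k ≡ a
[a+k]-k≡a = solve-∀

move-right : ∀ a b k → a ≤ℤ k +ℤ b → a -ℤ b ≤ℤ k
move-right a b k a≤k+b = ℤP.≤-trans (ℤP.+-monoˡ-≤ (-ℤ b) a≤k+b) (ℤP.≤-reflexive ([a+k]-k≡a k b))

move-left : ∀ a b k → a +ℤ k ≤ℤ b → a ≤ℤ b -ℤ k
move-left a b k a+k≤b = ℤP.≤-trans (ℤP.≤-reflexive (sym ([a+k]-k≡a a k))) (ℤP.+-monoˡ-≤ (-ℤ k) a+k≤b)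

+ℤ-cancelʳ-≤ : ∀ a b k → a +ℤ k ≤ℤ b +ℤ k → a ≤ℤ b
+ℤ-cancelʳ-≤ a b k a+k≤b+k = ℤP.≤-trans (move-left a (b +ℤ k) k a+k≤b+k) (ℤP.≤-reflexive ([a+k]-k≡a b k))

equal-steps⇒equal-differences : ∀ a b d e c → a -ℤ d ≡ c → b -ℤ e ≡ c → a -ℤ b ≡ d -ℤ e
equal-steps⇒equal-differences a b d e c a-d≡c b-e≡c = begin
  a -ℤ b                                ≡⟨ expand a b d e ⟩
  (a -ℤ d) -ℤ (b -ℤ e) +ℤ (d -ℤ e)      ≡⟨ cong₂ (λ u v → u -ℤ v +ℤ (d -ℤ e)) a-d≡c b-e≡c ⟩
  c -ℤ c +ℤ (d -ℤ e)                    ≡⟨ collapse c (d -ℤ e) ⟩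
  d -ℤ e                                ∎
  where
  open ≡-Reasoning
  expand : ∀ a b d e → a -ℤ b ≡ (a -ℤ d) -ℤ (b -ℤ e) +ℤ (d -ℤ e)
  expand = solve-∀
  collapse : ∀ c u → c -ℤ c +ℤ u ≡ u
  collapse = solve-∀

/-≤⇒cross-≤ : ∀ a b m n → a / suc m ≤ℚ b / suc n → a *ℤ + suc n ≤ℤ b *ℤ + suc m
/-≤⇒cross-≤ a b m n a/m≤b/n =
  ℚᵘ.drop-*≤* (ℚᵘ.≤-respʳ-≃ (toℚᵘ-fromℚᵘ (mkℚᵘ b n))
                (ℚᵘ.≤-respˡ-≃ (toℚᵘ-fromℚᵘ (mkℚᵘ a m)) (toℚᵘ-mono-≤ a/m≤b/n)))

same-residue⇒∣ : ∀ n .{{_ : NonZero n}} {A B D} → A ≡ D + B → A % n ≡ B % n → n ∣ D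
same-residue⇒∣ n {A} {B} {D} A≡D+B same = divides (A div n ∸ B div n) (sym D-as-multiple)
  where
  open ≡-Reasoning
  r : ℕ
  r = B % n
  quotients : A div n * n ≡ D + B div n * n
  quotients = +-cancelˡ-≡ r _ _ (begin
    r + A div n * n       ≡⟨ cong (_+ A div n * n) (sym same) ⟩
    A % n + A div n * n   ≡⟨ sym (m≡m%n+[m/n]*n A n) ⟩
    A                   ≡⟨ A≡D+B ⟩
    D + B               ≡⟨ cong (λ z → D + z) (m≡m%n+[m/n]*n B n) ⟩
    D + (r + B div n * n) ≡⟨ sym (+-assoc D r _) ⟩
    D + r + B div n * n   ≡⟨ cong (_+ B div n * n) (+-comm D r) ⟩
    r + D + B div n * n   ≡⟨ +-assoc r D _ ⟩
    r + (D + B div n * n) ∎)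
  D-as-multiple : (A div n ∸ B div n) * n ≡ D
  D-as-multiple = begin
    (A div n ∸ B div n) * n         ≡⟨ *-distribʳ-∸ n (A div n) (B div n) ⟩
    A div n * n ∸ B div n * n       ≡⟨ cong (_∸ B div n * n) quotients ⟩
    D + B div n * n ∸ B div n * n   ≡⟨ m+n∸n≡m D (B div n * n) ⟩
    D                           ∎

residue-collision : ∀ n .{{_ : NonZero n}} (f : ℕ → ℕ) →
  ∃₂ λ i d → 0 < d × i + d ≤ n × f i % n ≡ f (i + d) % n
residue-collision n f
  with i , j , i<j , same-mod ← pigeonhole (n<1+n n) (λ l → f (toℕ l) mod n)
  with o , i+1+o≡j ← m≤n⇒∃[o]m+o≡n i<j
  = toℕ i , suc o , z<s , i+d≤n , residues
  where
  i+d≡j : toℕ i + suc o ≡ toℕ j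
  i+d≡j = trans (+-suc (toℕ i) o) i+1+o≡j
  i+d≤n : toℕ i + suc o ≤ n
  i+d≤n = subst (_≤ n) (sym i+d≡j) (s≤s⁻¹ (toℕ<n j))
  residues : f (toℕ i) % n ≡ f (toℕ i + suc o) % n
  residues = trans (fromℕ<-injective _ _ _ _ same-mod) (cong (λ m → f m % n) (sym i+d≡j))

larger-part-≥ : ∀ M a b → M + M ≤ suc (a + b) → a ≤ b → M ≤ b
larger-part-≥ M a b M+M≤n a≤b with M ≤? b
... | yes M≤b = M≤b
... | no  M≰b = contradiction too-big 1+n≰n
  where
  b<M : b < M
  b<M = ≰⇒> M≰b
  too-big : suc (suc (a + b)) ≤ suc (a + b)
  too-big = ≤-trans (≤-reflexive (cong suc (sym (+-suc a b))))
              (≤-trans (+-mono-≤ (≤-trans (s≤s a≤b) b<M) b<M) M+M≤n)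

module Recurrence (t : ℕ) (x0 : Fin (suc t) → ℤ) (β : ℤ) where

  X : ℕ → ℤ
  X = seqX t x0 β

  Y : ℕ → ℤ
  Y n = X n +ℤ β

  X-diff≡Y-diff : ∀ a b → X a -ℤ X b ≡ Y a -ℤ Y b
  X-diff≡Y-diff a b = shift (X a) (X b) β
    where
    shift : ∀ x y b → x -ℤ y ≡ (x +ℤ b) -ℤ (y +ℤ b)
    shift = solve-∀

  approx-stable : ∀ m i → i < m → approx t x0 β (suc m) i ≡ approx t x0 β m i
  approx-stable m i i<m with i <? m
  ... | yes _   = refl
  ... | no  i≮m = contradiction i<m i≮m

  approx-correct : ∀ m i → i < m → approx t x0 β m i ≡ X i
  approx-correct m i i<m with m≤n⇒∃[o]m+o≡n i<m
  ... | k , refl = correct-after k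
    where
    correct-after : ∀ k → approx t x0 β (suc i + k) i ≡ X i
    correct-after zero    rewrite +-identityʳ i = refl
    correct-after (suc k) rewrite +-suc i k =
      trans (approx-stable (suc i + k) i (s≤s (m≤m+n i k))) (correct-after k)

  X-recurrence : ∀ n → t < n → X n ≡ β +ℤ minUpTo (n ∸ 1) (λ j → X j +ℤ X ((n ∸ 1) ∸ j))
  X-recurrence n t<n with n <? n
  ... | yes n<n = contradiction n<n (<-irrefl refl)
  ... | no _ with n ≤? t
  ...   | yes n≤t = contradiction n≤t (<⇒≱ t<n)
  ...   | no _ = cong (β +ℤ_) (minUpTo-cong (n ∸ 1) _ _ λ j j≤ →
                   cong₂ _+ℤ_ (approx-correct n j (below j j≤))
                              (approx-correct n _ (below _ (m∸n≤m (n ∸ 1) j))))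
    where
    below : ∀ j → j ≤ n ∸ 1 → j < n
    below j j≤ = ≤-trans (s≤s j≤) (≤-reflexive (m+[n∸m]≡n (≤-trans z<s t<n)))

  Y-recurrence : ∀ n → t < n → Y n ≡ minUpTo (n ∸ 1) (λ j → Y j +ℤ Y ((n ∸ 1) ∸ j))
  Y-recurrence n t<n = begin
    Y n                                       ≡⟨ cong (_+ℤ β) (X-recurrence n t<n) ⟩
    (β +ℤ minUpTo m g) +ℤ β                   ≡⟨ regroup β (minUpTo m g) ⟩
    minUpTo m g +ℤ (β +ℤ β)                   ≡⟨ minUpTo-+ m g (β +ℤ β) ⟩
    minUpTo m (λ j → g j +ℤ (β +ℤ β))         ≡⟨ minUpTo-cong m _ _ (λ j _ → regroup′ (X j) (X (m ∸ j)) β) ⟩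
    minUpTo m (λ j → Y j +ℤ Y (m ∸ j))        ∎
    where
    open ≡-Reasoning
    m : ℕ
    m = n ∸ 1
    g : ℕ → ℤ
    g j = X j +ℤ X (m ∸ j)
    regroup : ∀ b M → (b +ℤ M) +ℤ b ≡ M +ℤ (b +ℤ b)
    regroup = solve-∀
    regroup′ : ∀ x y b → (x +ℤ y) +ℤ (b +ℤ b) ≡ (x +ℤ b) +ℤ (y +ℤ b)
    regroup′ = solve-∀

  Y-subadditive : ∀ a b → t < suc (a + b) → Y (suc (a + b)) ≤ℤ Y a +ℤ Y b
  Y-subadditive a b t<n = ℤP.≤-trans (ℤP.≤-reflexive (Y-recurrence (suc (a + b)) t<n))
    (subst (λ z → minUpTo (a + b) g ≤ℤ Y a +ℤ Y z) (m+n∸m≡n a b) (minUpTo-≤ (a + b) g a (m≤m+n a b)))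
    where
    g : ℕ → ℤ
    g j = Y j +ℤ Y ((a + b) ∸ j)

  record OptimalSplit (n b : ℕ) : Set where
    constructor split
    field
      a     : ℕ
      a≤b   : a ≤ b
      sizes : suc (a + b) ≡ n
      cost  : Y n ≡ Y a +ℤ Y b

  optimalSplit : ∀ n → t < n → ∃ (OptimalSplit n)
  optimalSplit (suc m) t<n with minUpTo-attained m (λ j → Y j +ℤ Y (m ∸ j))
  ... | j , j≤m , min≡ with j ≤? m ∸ j
  ...   | yes j≤rest = m ∸ j , split j j≤rest (cong suc (m+[n∸m]≡n j≤m)) cost
    where
    cost : Y (suc m) ≡ Y j +ℤ Y (m ∸ j)
    cost = trans (Y-recurrence (suc m) t<n) min≡
  ...   | no  j≰rest = j , split (m ∸ j) (<⇒≤ (≰⇒> j≰rest))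
                         (cong suc (trans (+-comm (m ∸ j) j) (m+[n∸m]≡n j≤m)))
                         (trans (trans (Y-recurrence (suc m) t<n) min≡) (ℤP.+-comm (Y j) _))

  -- The spine of s: follow the larger part of an optimal split while above t.
  next : ℕ → ℕ
  next s with t <? s
  ... | yes t<s = proj₁ (optimalSplit s t<s)
  ... | no  _   = s

  next-split : ∀ s → t < s → OptimalSplit s (next s)
  next-split s t<s with t <? s
  ... | yes t<s′ = proj₂ (optimalSplit s t<s′)
  ... | no  t≮s  = contradiction t<s t≮s

  spine : ℕ → ℕ → ℕ
  spine s zero    = s
  spine s (suc l) = spine (next s) l

  spine-+ : ∀ i d s → spine s (i + d) ≡ spine (spine s i) d
  spine-+ zero    d s = refl
  spine-+ (suc i) d s = spine-+ i d (next s)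

  HighFor : ℕ → ℕ → Set
  HighFor n s = ∀ l → l < n → t < spine s l

  high-drop : ∀ i n s → HighFor (i + n) s → HighFor n (spine s i)
  high-drop i n s high l l<n = subst (t <_) (spine-+ i l s) (high (i + l) (+-monoʳ-< i l<n))

  high-prefix : ∀ {m n} s → m ≤ n → HighFor n s → HighFor m s
  high-prefix s m≤n high l l<m = high l (≤-trans l<m m≤n)

  -- The spine halves at worst, so it stays above t for l steps from 2^l (t+1) on.
  spine-high : ∀ l s → 2 ^ l * suc t ≤ s → t < spine s l
  spine-high zero    s h = ≤-trans (≤-reflexive (sym (*-identityˡ (suc t)))) h
  spine-high (suc l) s h = spine-high l (next s) (larger-part-≥ M a (next s) M+M≤n a≤b)
    where
    M : ℕ
    M = 2 ^ l * suc t
    M+M≡ : 2 ^ suc l * suc t ≡ M + M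
    M+M≡ = trans (*-assoc 2 (2 ^ l) (suc t)) (cong (λ z → M + z) (+-identityʳ M))
    t<s : t < s
    t<s = ≤-trans (m≤n*m (suc t) (2 ^ suc l) {{m^n≢0 2 (suc l)}}) h
    open OptimalSplit (next-split s t<s)
    M+M≤n : M + M ≤ suc (a + next s)
    M+M≤n = ≤-trans (≤-reflexive (sym M+M≡)) (≤-trans h (≤-reflexive (sym sizes)))

  spine-excision : ∀ i s E M → HighFor i s → spine s i ≡ E + M → t < M →
    ∃ λ R → s ≡ E + R × t < R × Y (spine s i) +ℤ Y R ≤ℤ Y s +ℤ Y M
  spine-excision zero    s E M _    s≡E+M t<M = M , s≡E+M , t<M , ℤP.≤-refl
  spine-excision (suc i) s E M high eq t<M
    with R , b≡E+R , t<R , ineq ← spine-excision i (next s) E M (high-drop 1 i s high) eq t<M =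
    suc (a + R) , sizes′ , t<R′ , cost′
    where
    open OptimalSplit (next-split s (high 0 z<s))
    b : ℕ
    b = next s
    S : ℕ
    S = spine b i
    t<R′ : t < suc (a + R)
    t<R′ = ≤-trans t<R (m≤n⇒m≤1+n (m≤n+m R a))
    sizes′ : s ≡ E + suc (a + R)
    sizes′ = trans (sym sizes) (trans (cong (λ z → suc (a + z)) b≡E+R) (reorder a E R))
      where
      reorder : ∀ a E R → suc (a + (E + R)) ≡ E + suc (a + R)
      reorder = solve-ℕ
    cost′ : Y S +ℤ Y (suc (a + R)) ≤ℤ Y s +ℤ Y M
    cost′ = begin
      Y S +ℤ Y (suc (a + R))    ≤⟨ ℤP.+-monoʳ-≤ (Y S) (Y-subadditive a R t<R′) ⟩
      Y S +ℤ (Y a +ℤ Y R)       ≡⟨ swap (Y S) (Y a) (Y R) ⟩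
      Y a +ℤ (Y S +ℤ Y R)       ≤⟨ ℤP.+-monoʳ-≤ (Y a) ineq ⟩
      Y a +ℤ (Y b +ℤ Y M)       ≡⟨ sym (ℤP.+-assoc (Y a) (Y b) (Y M)) ⟩
      (Y a +ℤ Y b) +ℤ Y M       ≡⟨ cong (_+ℤ Y M) (sym cost) ⟩
      Y s +ℤ Y M                ∎
      where
      open ℤP.≤-Reasoning
      swap : ∀ x y z → x +ℤ (y +ℤ z) ≡ y +ℤ (x +ℤ z)
      swap = solve-∀

module Periodicity (t : ℕ) (x0 : Fin (suc t) → ℤ) (β : ℤ) (p : ℕ) (p≤t : p ≤ t)
  (slope : ∀ j → j ≤ t → (seqX t x0 β p +ℤ β) *ℤ + suc j ≤ℤ (seqX t x0 β j +ℤ β) *ℤ + suc p) where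

  open Recurrence t x0 β

  q : ℕ
  q = suc p

  c : ℤ
  c = Y p

  slope-bound : ∀ ν → c *ℤ + suc ν ≤ℤ Y ν *ℤ + q
  slope-bound = <-rec _ bound
    where
    bound : ∀ ν → (∀ {μ} → μ < ν → c *ℤ + suc μ ≤ℤ Y μ *ℤ + q) → c *ℤ + suc ν ≤ℤ Y ν *ℤ + q
    bound ν ih with ν ≤? t
    ... | yes ν≤t = slope ν ν≤t
    ... | no  ν≰t with optimalSplit ν (≰⇒> ν≰t)
    ...   | b , split a _ refl cost = begin
      c *ℤ + (suc (suc (a + b)))        ≡⟨ cong (λ z → c *ℤ + z) (sym (+-suc (suc a) b)) ⟩
      c *ℤ + (suc a + suc b)            ≡⟨ cong (c *ℤ_) (ℤP.pos-+ (suc a) (suc b)) ⟩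
      c *ℤ (+ suc a +ℤ + suc b)         ≡⟨ ℤP.*-distribˡ-+ c (+ suc a) (+ suc b) ⟩
      c *ℤ + suc a +ℤ c *ℤ + suc b      ≤⟨ ℤP.+-mono-≤ (ih (s≤s (m≤m+n a b))) (ih (s≤s (m≤n+m b a))) ⟩
      Y a *ℤ + q +ℤ Y b *ℤ + q          ≡⟨ sym (ℤP.*-distribʳ-+ (+ q) (Y a) (Y b)) ⟩
      (Y a +ℤ Y b) *ℤ + q               ≡⟨ cong (_*ℤ + q) (sym cost) ⟩
      Y (suc (a + b)) *ℤ + q            ∎
      where open ℤP.≤-Reasoning

  growth : ∀ k → + k *ℤ c ≤ℤ X (p + k * q) -ℤ X p
  growth k = subst (+ k *ℤ c ≤ℤ_) (sym (X-diff≡Y-diff (p + k * q) p)) (move-left _ _ c Y≥)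
    where
    Y≥ : + k *ℤ c +ℤ c ≤ℤ Y (p + k * q)
    Y≥ = ℤP.*-cancelʳ-≤-pos _ _ (+ q) (ℤP.≤-trans (ℤP.≤-reflexive (begin
      (+ k *ℤ c +ℤ c) *ℤ + q      ≡⟨ regroup c (+ k) (+ q) ⟩
      c *ℤ (+ q +ℤ + k *ℤ + q)    ≡⟨ cong (c *ℤ_) (sym (trans (ℤP.pos-+ q (k * q)) (cong (+ q +ℤ_) (ℤP.pos-* k q)))) ⟩
      c *ℤ + suc (p + k * q)      ∎)) (slope-bound (p + k * q)))
      where
      open ≡-Reasoning
      regroup : ∀ c k q → (k *ℤ c +ℤ c) *ℤ q ≡ c *ℤ (q +ℤ k *ℤ q)
      regroup = solve-∀

  shift-≤ : ∀ ν → t < ν → Y ν ≤ℤ c +ℤ Y (ν ∸ q)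
  shift-≤ ν t<ν = subst (λ n → Y n ≤ℤ c +ℤ Y (ν ∸ q)) (m+[n∸m]≡n q≤ν)
                        (Y-subadditive p (ν ∸ q) (subst (t <_) (sym (m+[n∸m]≡n q≤ν)) t<ν))
    where
    q≤ν : q ≤ ν
    q≤ν = ≤-trans (s≤s p≤t) t<ν

  shift-repeat-≤ : ∀ k μ → t < μ → Y (μ + k * q) ≤ℤ Y μ +ℤ + k *ℤ c
  shift-repeat-≤ zero    μ _   = ℤP.≤-reflexive (trans (cong Y (+-identityʳ μ)) (sym (ℤP.+-identityʳ (Y μ))))
  shift-repeat-≤ (suc k) μ t<μ = begin
    Y (μ + suc k * q)                  ≤⟨ shift-≤ _ (≤-trans t<μ (m≤m+n μ _)) ⟩
    c +ℤ Y (μ + suc k * q ∸ q)         ≡⟨ cong (λ n → c +ℤ Y n) drop-period ⟩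
    c +ℤ Y (μ + k * q)                 ≤⟨ ℤP.+-monoʳ-≤ c (shift-repeat-≤ k μ t<μ) ⟩
    c +ℤ (Y μ +ℤ + k *ℤ c)             ≡⟨ regroup c (Y μ) (+ k) ⟩
    Y μ +ℤ (1ℤ +ℤ + k) *ℤ c            ∎
    where
    open ℤP.≤-Reasoning
    regroup : ∀ c y k → c +ℤ (y +ℤ k *ℤ c) ≡ y +ℤ (1ℤ +ℤ k) *ℤ c
    regroup = solve-∀
    drop-period : μ + suc k * q ∸ q ≡ μ + k * q
    drop-period = trans (cong (_∸ q) (reorder μ k q)) (m+n∸n≡m (μ + k * q) q)
      where
      reorder : ∀ μ k q → μ + suc k * q ≡ μ + k * q + q
      reorder = solve-ℕ

  spine-descent : ∀ d s → HighFor d s →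
    ∃ λ D → d ≤ D × s ≡ D + spine s d × c *ℤ + D +ℤ Y (spine s d) *ℤ + q ≤ℤ Y s *ℤ + q
  spine-descent zero    s _    = 0 , z≤n , refl , ℤP.≤-reflexive (trans (cong (_+ℤ Y s *ℤ + q) (ℤP.*-zeroʳ c)) (ℤP.+-identityˡ _))
  spine-descent (suc d) s high
    with D , d≤D , b≡D+S , ineq ← spine-descent d (next s) (high-drop 1 d s high) =
    suc a + D , s≤s (≤-trans d≤D (m≤n+m D a)) , sizes′ , cost′
    where
    open OptimalSplit (next-split s (high 0 z<s))
    S : ℕ
    S = spine (next s) d
    sizes′ : s ≡ suc a + D + S
    sizes′ = trans (sym sizes) (cong suc (trans (cong (λ z → a + z) b≡D+S) (sym (+-assoc a D S))))
    cost′ : c *ℤ + (suc a + D) +ℤ Y S *ℤ + q ≤ℤ Y s *ℤ + q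
    cost′ = begin
      c *ℤ + (suc a + D) +ℤ Y S *ℤ + q           ≡⟨ cong (λ z → c *ℤ z +ℤ Y S *ℤ + q) (ℤP.pos-+ (suc a) D) ⟩
      c *ℤ (+ suc a +ℤ + D) +ℤ Y S *ℤ + q        ≡⟨ regroup c (+ suc a) (+ D) (Y S *ℤ + q) ⟩
      c *ℤ + suc a +ℤ (c *ℤ + D +ℤ Y S *ℤ + q)   ≤⟨ ℤP.+-mono-≤ (slope-bound a) ineq ⟩
      Y a *ℤ + q +ℤ Y (next s) *ℤ + q            ≡⟨ sym (ℤP.*-distribʳ-+ (+ q) (Y a) (Y (next s))) ⟩
      (Y a +ℤ Y (next s)) *ℤ + q                 ≡⟨ cong (_*ℤ + q) (sym cost) ⟩
      Y s *ℤ + q                                 ∎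
      where
      open ℤP.≤-Reasoning
      regroup : ∀ c a D y → c *ℤ (a +ℤ D) +ℤ y ≡ c *ℤ a +ℤ (c *ℤ D +ℤ y)
      regroup = solve-∀

  spine-cycle : ∀ d s → 0 < d → HighFor d s → s % q ≡ spine s d % q →
    ∃ λ k → s ≡ suc k * q + spine s d × + suc k *ℤ c +ℤ Y (spine s d) ≤ℤ Y s
  spine-cycle d s 0<d high same
    with D , d≤D , s≡D+S , ineq ← spine-descent d s high
    with same-residue⇒∣ q s≡D+S same
  ... | divides zero    D≡0  = contradiction (≤-trans 0<d (≤-trans d≤D (≤-reflexive D≡0))) (λ ())
  ... | divides (suc k) D≡kq =
    k , trans s≡D+S (cong (_+ spine s d) D≡kq) ,
    ℤP.*-cancelʳ-≤-pos _ _ (+ q) (ℤP.≤-trans (ℤP.≤-reflexive cycle-cost) ineq)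
    where
    S : ℕ
    S = spine s d
    regroup : ∀ c k q y → (k *ℤ c +ℤ y) *ℤ q ≡ c *ℤ (k *ℤ q) +ℤ y *ℤ q
    regroup = solve-∀
    cycle-cost : (+ suc k *ℤ c +ℤ Y S) *ℤ + q ≡ c *ℤ + D +ℤ Y S *ℤ + q
    cycle-cost = trans (regroup c (+ suc k) (+ q) (Y S))
                       (cong (λ z → c *ℤ z +ℤ Y S *ℤ + q) (sym (trans (cong +_ D≡kq) (ℤP.pos-* (suc k) q))))

  shift-≥-from-cycle : ∀ ν i d → 0 < d → HighFor (suc (i + d)) ν →
    spine ν i % q ≡ spine ν (i + d) % q → c +ℤ Y (ν ∸ q) ≤ℤ Y ν
  shift-≥-from-cycle ν i d 0<d high same
    with k , S≡kq+S′ , cycle ← spine-cycle d (spine ν i) 0<d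
                                 (high-drop i d ν (high-prefix ν (n≤1+n (i + d)) high))
                                 (trans same (cong (_% q) (spine-+ i d ν)))
    with R , ν≡kq+R , t<R , excise ← spine-excision i ν (suc k * q) (spine (spine ν i) d)
                                       (high-prefix ν (≤-trans (m≤m+n i d) (n≤1+n (i + d))) high)
                                       S≡kq+S′ (subst (t <_) (spine-+ i d ν) (high (i + d) ≤-refl))
    = +ℤ-cancelʳ-≤ _ _ (Y S′) (begin
      c +ℤ Y (ν ∸ q) +ℤ Y S′                 ≡⟨ cong (λ n → c +ℤ Y n +ℤ Y S′) ν-q≡R+kq ⟩
      c +ℤ Y (R + k * q) +ℤ Y S′             ≤⟨ ℤP.+-monoˡ-≤ (Y S′) (ℤP.+-monoʳ-≤ c (shift-repeat-≤ k R t<R)) ⟩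
      c +ℤ (Y R +ℤ + k *ℤ c) +ℤ Y S′         ≡⟨ regroup c (Y R) (+ k) (Y S′) ⟩
      ((1ℤ +ℤ + k) *ℤ c +ℤ Y S′) +ℤ Y R     ≤⟨ ℤP.+-monoˡ-≤ (Y R) cycle ⟩
      Y (spine ν i) +ℤ Y R                   ≤⟨ excise ⟩
      Y ν +ℤ Y S′                            ∎)
    where
    S′ : ℕ
    S′ = spine (spine ν i) d
    ν-q≡R+kq : ν ∸ q ≡ R + k * q
    ν-q≡R+kq = trans (cong (_∸ q) (trans ν≡kq+R (reorder q k R))) (m+n∸m≡n q (R + k * q))
      where
      reorder : ∀ q k R → suc k * q + R ≡ q + (R + k * q)
      reorder = solve-ℕ
    regroup : ∀ c y k z → c +ℤ (y +ℤ k *ℤ c) +ℤ z ≡ ((1ℤ +ℤ k) *ℤ c +ℤ z) +ℤ y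
    regroup = solve-∀
    open ℤP.≤-Reasoning

  -- From this index on, the spine of ν stays above t for q + 1 steps.
  N₀ : ℕ
  N₀ = 2 ^ q * suc t

  shift-≡ : ∀ ν → N₀ ≤ ν → Y ν ≡ c +ℤ Y (ν ∸ q)
  shift-≡ ν N₀≤ν with i , d , 0<d , i+d≤q , same ← residue-collision q (spine ν) =
    ℤP.≤-antisym (shift-≤ ν (spine-high 0 ν (≤-trans (early z≤n) N₀≤ν)))
                (shift-≥-from-cycle ν i d 0<d high same)
    where
    early : ∀ {l} → l ≤ q → 2 ^ l * suc t ≤ N₀
    early l≤q = *-monoˡ-≤ (suc t) (^-monoʳ-≤ 2 l≤q)
    high : HighFor (suc (i + d)) ν
    high l l≤i+d = spine-high l ν (≤-trans (early (≤-trans (s≤s⁻¹ l≤i+d) i+d≤q)) N₀≤ν)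

  increment-≤ : ∀ ν → suc t ≤ ν → X ν -ℤ X (ν ∸ q) ≤ℤ c
  increment-≤ ν t<ν = subst (_≤ℤ c) (sym (X-diff≡Y-diff ν (ν ∸ q))) (move-right _ _ c (shift-≤ ν t<ν))

  increment-≡ : ∀ ν → N₀ ≤ ν → X ν -ℤ X (ν ∸ q) ≡ c
  increment-≡ ν N₀≤ν = trans (X-diff≡Y-diff ν (ν ∸ q))
    (trans (cong (_-ℤ Y (ν ∸ q)) (shift-≡ ν N₀≤ν)) ([a+k]-k≡a c (Y (ν ∸ q))))

  differences-periodic : ∀ ν → N₀ ≤ ν → X (ν + q + 1) -ℤ X (ν + q) ≡ X (ν + 1) -ℤ X ν
  differences-periodic ν N₀≤ν = equal-steps⇒equal-differences (X (ν + q + 1)) (X (ν + q)) (X (ν + 1)) (X ν) c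
    (trans (cong (λ n → X (ν + q + 1) -ℤ X n) (sym back-one))
           (increment-≡ (ν + q + 1) (≤-trans N₀≤ν (≤-trans (m≤m+n ν q) (m≤m+n _ 1)))))
    (trans (cong (λ n → X (ν + q) -ℤ X n) (sym (m+n∸n≡m ν q)))
           (increment-≡ (ν + q) (≤-trans N₀≤ν (m≤m+n ν q))))
    where
    back-one : ν + q + 1 ∸ q ≡ ν + 1
    back-one = trans (cong (_∸ q) (reorder ν q)) (m+n∸n≡m (ν + 1) q)
      where
      reorder : ∀ ν q → ν + q + 1 ≡ ν + 1 + q
      reorder = solve-ℕ

lemma15 : (t : ℕ) (x0 : Fin (suc t) → ℤ) (β : ℤ) (p : ℕ) (p≤t : p ≤ t) →
    (∀ (j : ℕ) → j ≤ t → ((seqX t x0 β p +ℤ β) / suc p) ≤ℚ ((seqX t x0 β j +ℤ β) / suc j)) →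
    (∃ λ N → ∀ ν → N ≤ ν →
        seqX t x0 β (ν + suc p + 1) -ℤ seqX t x0 β (ν + suc p) ≡ seqX t x0 β (ν + 1) -ℤ seqX t x0 β ν)
    × (∀ ν → suc t ≤ ν → seqX t x0 β ν -ℤ seqX t x0 β (ν ∸ suc p) ≤ℤ seqX t x0 β p +ℤ β)
    × (∃ λ N → ∀ ν → N ≤ ν → seqX t x0 β ν -ℤ seqX t x0 β (ν ∸ suc p) ≡ seqX t x0 β p +ℤ β)
    × (∀ k → 1 ≤ k → (+ k) *ℤ (seqX t x0 β p +ℤ β) ≤ℤ seqX t x0 β (p + k * suc p) -ℤ seqX t x0 β p)
lemma15 t x0 β p p≤t argmin =
  (N₀ , differences-periodic) , increment-≤ , (N₀ , increment-≡) , (λ k _ → growth k)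
  where
  slope : ∀ j → j ≤ t → (seqX t x0 β p +ℤ β) *ℤ + suc j ≤ℤ (seqX t x0 β j +ℤ β) *ℤ + suc p
  slope j j≤t = /-≤⇒cross-≤ (seqX t x0 β p +ℤ β) (seqX t x0 β j +ℤ β) p j (argmin j j≤t)
  open Periodicity t x0 β p p≤t slope
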